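{- Let $a,r\in\mathbb{N}$ and $a_n=a+(n-1)r$ for $n\ge1$. Then the sequence $(\Gamma(a_n,a_{n+1}))_{n\ge1}$ is either $1,2,1,2,\ldots$ or $2,1,2,1,\ldots$.
   Context: $\mathbb{N}$ denotes the positive integers. For coprime $a,b\in\mathbb{N}$, consider the equations (E1) $ax+by=\frac{(a-1)(b-1)}{2}$ and (E2) $ax+by+1=\frac{(a-1)(b-1)}{2}$. We say the pair $(a,b)$ uses (E1) if (E1) has a solution in nonnegative integers $x,y$. For arbitrary $a,b\in\mathbb{N}$ with $d=\gcd(a,b)$, define $\Gamma(a,b)=1$ if the coprime pair $(a/d,b/d)$ uses (E1), and $\Gamma(a,b)=2$ otherwise. -}

module Defs where

open import Data.Nat using (ℕ; zero; suc; _+_; _*_; _∸_; _/_; _≥_)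
open import Data.Nat.GCD using (gcd)
open import Data.Nat.Divisibility using (_∣_)
open import Data.Product using (Σ; ∃; _×_; _,_)
open import Data.Sum using (_⊎_)
open import Relation.Nullary using (¬_)
open import Relation.Binary.PropositionalEquality using (_≡_)

-- (a-1)(b-1)/2 ; for coprime a,b ≥ 1 the product (a-1)(b-1) is even,
-- so the division by 2 is exact.
half : ℕ → ℕ → ℕ
half a b = ((a ∸ 1) * (b ∸ 1)) / 2

UsesE1 : ℕ → ℕ → Set
UsesE1 a b = ∃ λ x → ∃ λ y → a * x + b * y ≡ half a b

-- (E2) has a nonnegative integer solution (not needed for Γ, recorded for reference)
SolvesE2 : ℕ → ℕ → Set
SolvesE2 a b = ∃ λ x → ∃ λ y → a * x + b * y + 1 ≡ half a b

Reduced : ℕ → ℕ → ℕ → ℕ → Set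
Reduced a b a' b' = (a ≡ gcd a b * a') × (b ≡ gcd a b * b')

GammaIs : ℕ → ℕ → ℕ → Set
GammaIs a b k = ∃ λ a' → ∃ λ b' → Reduced a b a' b' ×
  ((k ≡ 1 × UsesE1 a' b') ⊎ (k ≡ 2 × ¬ UsesE1 a' b'))

ap : ℕ → ℕ → ℕ → ℕ
ap a r n = a + (n ∸ 1) * r

Even : ℕ → Set
Even n = 2 ∣ n

{-# OPTIONS --safe #-}
module Submission where

open import Defs
open import Data.Nat using (ℕ; zero; suc; _+_; _*_; _∸_; _/_; _%_; _≤_; _<_; _≥_; _≤?_; NonZero; ≢-nonZero; ≢-nonZero⁻¹; >-nonZero; >-nonZero⁻¹)
open import Data.Nat.Properties
open import Data.Nat.DivMod using (m≡m%n+[m/n]*n; m%n<n; m*[n/m]≡n)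
open import Data.Nat.Divisibility using (_∣_; divides; _∣0; ∣1⇒≡1; ∣m+n∣m⇒∣n; ∣m⇒∣m*n; ∣n⇒∣m*n; m∣m*n; n∣m*n; ∣⇒≤)
open import Data.Nat.GCD using (module Bézout; gcd; gcd[m,n]∣m; gcd[m,n]∣n; gcd[m,n]≢0; c*gcd[m,n]≡gcd[cm,cn])
open import Data.Nat.Coprimality using (Coprime; coprime-+; coprime-/gcd; coprime⇒gcd≡1; coprime-Bézout; coprime-divisor) renaming (sym to coprime-sym)
open import Data.Nat.Tactic.RingSolver using (solve)
open import Data.List using (_∷_; [])
open import Data.Product using (∃-syntax; _×_; _,_; proj₁; proj₂)
open import Data.Sum using (_⊎_; inj₁; inj₂)
open import Function using (_∘_; const)
open import Relation.Nullary using (¬_; yes; no; contradiction)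
open import Relation.Binary.PropositionalEquality using (_≡_; refl; sym; cong; cong₂; subst; module ≡-Reasoning)

-- Write a = d a′ and r = d s with a′, s coprime.  The pair (a_n, a_{n+1}) then
-- reduces to (A, A + s) with A = a′ + (n − 1) s, so Γ only depends on whether
-- (E1) is solvable for consecutive terms of the coprime progression a′, a′ + s, ….
-- For three consecutive terms A, B = A + s, C = B + s, with h(X, Y) = (X − 1)(Y − 1)/2,
--   A · h(B, C) + C · h(A, B) + B (B − 1) = A C (B − 1).
-- Read modulo B, it says that solutions x of (E1) for (A, B) and v of (E1) for (B, C)
-- satisfy x + v ≡ −1, and read as an inequality it says x + v < B − 1: so at most one
-- pair uses (E1).  Conversely, if (A, B) does not use (E1), the residue x < B of
-- h(A, B)/A modulo B overshoots, and v = B − 1 − x gives a solution for (B, C).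
-- So exactly one of two consecutive pairs uses (E1), and Γ alternates.

even-or-odd : ∀ n → Even n ⊎ Even (suc n)
even-or-odd zero = inj₁ (2 ∣0)
even-or-odd (suc n) with even-or-odd n
... | inj₁ (divides q n≡q*2) = inj₂ (divides (suc q) (cong (2 +_) n≡q*2))
... | inj₂ even-suc = inj₁ even-suc

even⇒¬even-suc : ∀ {n} → Even n → ¬ Even (suc n)
even⇒¬even-suc {n} even-n even-suc =
  contradiction (∣1⇒≡1 (∣m+n∣m⇒∣n (subst (2 ∣_) (+-comm 1 n) even-suc) even-n)) λ ()

even-suc⇒¬even : ∀ {n} → Even (suc n) → ¬ Even n
even-suc⇒¬even even-suc even-n = even⇒¬even-suc even-n even-suc

¬even-suc⇒even : ∀ {n} → ¬ Even (suc n) → Even n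
¬even-suc⇒even {n} odd-suc with even-or-odd n
... | inj₁ even-n = even-n
... | inj₂ even-suc = contradiction even-suc odd-suc

module _ {P : ℕ → Set} (P-or-next : ∀ n → P n ⊎ P (suc n))
                       (¬P-and-next : ∀ n → ¬ (P n × P (suc n))) where

  private
    ¬P⇒P-next : ∀ {n} → ¬ P n → P (suc n)
    ¬P⇒P-next {n} ¬Pn with P-or-next n
    ... | inj₁ Pn = contradiction Pn ¬Pn
    ... | inj₂ P-next = P-next

  holds-on-evens : P 0 → ∀ n → (Even n → P n) × (¬ Even n → ¬ P n)
  holds-on-evens P0 zero = const P0 , λ odd-0 → contradiction (2 ∣0) odd-0
  holds-on-evens P0 (suc n) =
    (λ even → ¬P⇒P-next (proj₂ ih (even-suc⇒¬even even))) ,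
    (λ odd P-next → ¬P-and-next n (proj₁ ih (¬even-suc⇒even odd) , P-next))
    where ih = holds-on-evens P0 n

  holds-on-odds : ¬ P 0 → ∀ n → (Even n → ¬ P n) × (¬ Even n → P n)
  holds-on-odds ¬P0 zero = const ¬P0 , λ odd-0 → contradiction (2 ∣0) odd-0
  holds-on-odds ¬P0 (suc n) =
    (λ even P-next → ¬P-and-next n (proj₂ ih (even-suc⇒¬even even) , P-next)) ,
    (λ odd → ¬P⇒P-next (proj₁ ih (¬even-suc⇒even odd)))
    where ih = holds-on-odds ¬P0 n

  parity-pattern : (∀ n → (Even n → P n) × (¬ Even n → ¬ P n))
                 ⊎ (∀ n → (Even n → ¬ P n) × (¬ Even n → P n))
  parity-pattern with P-or-next 0
  ... | inj₁ P0 = inj₁ (holds-on-evens P0)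
  ... | inj₂ P1 = inj₂ (holds-on-odds λ P0 → ¬P-and-next 0 (P0 , P1))

coprime-+ʳ : ∀ {m n} → Coprime m n → Coprime (m + n) n
coprime-+ʳ {m} {n} m⊥n = subst (λ k → Coprime k n) (+-comm n m) (coprime-+ m⊥n)

coprime-m,m+n : ∀ {m n} → Coprime m n → Coprime m (m + n)
coprime-m,m+n = coprime-sym ∘ coprime-+ ∘ coprime-sym

coprime-decomposition : ∀ m n .{{_ : NonZero m}} →
  ∃[ d ] ∃[ m′ ] ∃[ n′ ] m ≡ d * m′ × n ≡ d * n′ × Coprime m′ n′
coprime-decomposition m n =
  gcd m n , m / gcd m n , n / gcd m n ,
  sym (m*[n/m]≡n (gcd[m,n]∣m m n)) , sym (m*[n/m]≡n (gcd[m,n]∣n m n)) , coprime-/gcd m n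
  where
  instance
    gcd≢0 : NonZero (gcd m n)
    gcd≢0 = ≢-nonZero (gcd[m,n]≢0 m n (inj₁ (≢-nonZero⁻¹ m)))

2∣[m∸1]*[n∸1] : ∀ {m n} → Coprime m n → 2 ∣ (m ∸ 1) * (n ∸ 1)
2∣[m∸1]*[n∸1] {zero} _ = 2 ∣0
2∣[m∸1]*[n∸1] {suc m} {zero} _ = ∣n⇒∣m*n m (2 ∣0)
2∣[m∸1]*[n∸1] {suc m} {suc n} m⊥n with even-or-odd m | even-or-odd n
... | inj₁ even-m | _ = ∣m⇒∣m*n n even-m
... | inj₂ _ | inj₁ even-n = ∣n⇒∣m*n m even-n
... | inj₂ even-suc-m | inj₂ even-suc-n = contradiction (m⊥n (even-suc-m , even-suc-n)) λ ()

half-exact : ∀ {m n} → Coprime m n → 2 * half m n ≡ (m ∸ 1) * (n ∸ 1)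
half-exact m⊥n = m*[n/m]≡n (2∣[m∸1]*[n∸1] m⊥n)

Representable : ℕ → ℕ → ℕ → Set
Representable a b n = ∃[ x ] ∃[ y ] a * x + b * y ≡ n

reduced-scaled : ∀ d {a b} → Coprime a b → Reduced (d * a) (d * b) a b
reduced-scaled d {a} {b} a⊥b = cong (_* a) d≡gcd , cong (_* b) d≡gcd
  where
  d≡gcd : d ≡ gcd (d * a) (d * b)
  d≡gcd = begin
    d             ≡⟨ *-identityʳ d ⟨
    d * 1         ≡⟨ cong (d *_) (coprime⇒gcd≡1 a⊥b) ⟨
    d * gcd a b   ≡⟨ c*gcd[m,n]≡gcd[cm,cn] d a b ⟩
    gcd (d * a) (d * b) ∎
    where open ≡-Reasoning

gammaIs-scaled : ∀ d {a b} → Coprime a b →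
  (UsesE1 a b → GammaIs (d * a) (d * b) 1) × (¬ UsesE1 a b → GammaIs (d * a) (d * b) 2)
gammaIs-scaled d {a} {b} a⊥b =
  (λ uses → a , b , reduced-scaled d a⊥b , inj₁ (refl , uses)) ,
  (λ ¬uses → a , b , reduced-scaled d a⊥b , inj₂ (refl , ¬uses))

congruence-solvable : ∀ {a b} .{{_ : NonZero b}} → Coprime a b → ∀ n →
  ∃[ w ] ∃[ i ] ∃[ j ] a * w + b * i ≡ n + b * j
congruence-solvable {a} {suc b′} a⊥b n with coprime-Bézout a⊥b
... | Bézout.+- x y 1+yb≡xa = x * n , 0 , y * n , (begin
  a * (x * n) + suc b′ * 0  ≡⟨ solve (a ∷ b′ ∷ x ∷ n ∷ []) ⟩
  (x * a) * n               ≡⟨ cong (_* n) 1+yb≡xa ⟨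
  (1 + y * suc b′) * n      ≡⟨ solve (b′ ∷ y ∷ n ∷ []) ⟩
  n + suc b′ * (y * n)      ∎)
  where open ≡-Reasoning
-- Here x b′ inverts a modulo suc b′, since x a ≡ −1.
... | Bézout.-+ x y 1+xa≡yb = x * (b′ * n) , n , y * b′ * n , (begin
  a * (x * (b′ * n)) + suc b′ * n  ≡⟨ solve (a ∷ b′ ∷ x ∷ n ∷ []) ⟩
  n + (1 + x * a) * (b′ * n)       ≡⟨ cong (λ t → n + t * (b′ * n)) 1+xa≡yb ⟩
  n + (y * suc b′) * (b′ * n)      ≡⟨ solve (b′ ∷ y ∷ n ∷ []) ⟩
  n + suc b′ * (y * b′ * n)        ∎)
  where open ≡-Reasoning

congruence-solvable-below : ∀ {a b} .{{_ : NonZero b}} → Coprime a b → ∀ n →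
  ∃[ x ] x < b × ∃[ i ] ∃[ j ] a * x + b * i ≡ n + b * j
congruence-solvable-below {a} {b} a⊥b n with congruence-solvable a⊥b n
... | w , i , j , eq with w % b | m%n<n w b | w / b | m≡m%n+[m/n]*n w b
...   | x | x<b | q | w≡x+qb = x , x<b , i + a * q , j , (begin
  a * x + b * (i + a * q)  ≡⟨ solve (a ∷ b ∷ x ∷ q ∷ i ∷ []) ⟩
  a * (x + q * b) + b * i  ≡⟨ cong (λ t → a * t + b * i) w≡x+qb ⟨
  a * w + b * i            ≡⟨ eq ⟩
  n + b * j                ∎)
  where open ≡-Reasoning

representable-or-overshoots : ∀ {a b} .{{_ : NonZero b}} → Coprime a b → ∀ n →
  Representable a b n ⊎ ∃[ x ] x < b × ∃[ k ] a * x ≡ n + b * suc k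
representable-or-overshoots {a} {b} a⊥b n with congruence-solvable-below a⊥b n
... | x , x<b , i , j , eq with j ≤? i
...   | yes j≤i with m≤n⇒∃[o]m+o≡n j≤i
...     | k , j+k≡i = inj₁ (x , k , +-cancelˡ-≡ (b * j) _ _ (begin
    b * j + (a * x + b * k)  ≡⟨ solve (a ∷ b ∷ x ∷ j ∷ k ∷ []) ⟩
    a * x + b * (j + k)      ≡⟨ cong (λ t → a * x + b * t) j+k≡i ⟩
    a * x + b * i            ≡⟨ eq ⟩
    n + b * j                ≡⟨ +-comm n (b * j) ⟩
    b * j + n                ∎))
  where open ≡-Reasoning
representable-or-overshoots {a} {b} a⊥b n | x , x<b , i , j , eq | no j≰i
  with m≤n⇒∃[o]m+o≡n (≰⇒> j≰i)
... | k , i+1+k≡j = inj₂ (x , x<b , k , +-cancelˡ-≡ (b * i) _ _ (begin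
    b * i + a * x            ≡⟨ +-comm (b * i) (a * x) ⟩
    a * x + b * i            ≡⟨ eq ⟩
    n + b * j                ≡⟨ cong (λ t → n + b * t) i+1+k≡j ⟨
    n + b * (suc i + k)      ≡⟨ solve (n ∷ b ∷ i ∷ k ∷ []) ⟩
    b * i + (n + b * suc k)  ∎))
  where open ≡-Reasoning

module Consecutive (p s : ℕ) (A⊥s : Coprime (suc p) s)
                   {h₁ h₂ : ℕ} (2h₁ : 2 * h₁ ≡ p * (p + s))
                   (2h₂ : 2 * h₂ ≡ (p + s) * (p + s + s)) where

  -- The ring solver does not unfold A, B, C, so calculations spell them out.
  A B C : ℕ
  A = suc p
  B = A + s
  C = B + s

  A⊥B : Coprime A B
  A⊥B = coprime-m,m+n A⊥s

  B⊥C : Coprime B C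
  B⊥C = coprime-m,m+n (coprime-+ʳ A⊥s)

  half-identity : A * h₂ + C * h₁ + B * (p + s) ≡ A * C * (p + s)
  half-identity = *-cancelˡ-≡ _ _ 2 (begin
    2 * (suc p * h₂ + (suc p + s + s) * h₁ + (suc p + s) * (p + s))
      ≡⟨ solve (p ∷ s ∷ h₁ ∷ h₂ ∷ []) ⟩
    suc p * (2 * h₂) + (suc p + s + s) * (2 * h₁) + 2 * (suc p + s) * (p + s)
      ≡⟨ cong₂ (λ α β → A * α + C * β + 2 * B * (p + s)) 2h₂ 2h₁ ⟩
    suc p * ((p + s) * (p + s + s)) + (suc p + s + s) * (p * (p + s)) + 2 * (suc p + s) * (p + s)
      ≡⟨ solve (p ∷ s ∷ []) ⟩
    2 * (suc p * (suc p + s + s) * (p + s)) ∎)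
    where open ≡-Reasoning

  ¬representable-both : .{{_ : NonZero s}} → ¬ (Representable A B h₁ × Representable B C h₂)
  ¬representable-both ((x , y , Ax+By≡h₁) , (u , v , Bu+Cv≡h₂)) = <-irrefl refl (begin-strict
    A * (C * B)                    ≤⟨ *-monoʳ-≤ A (*-monoʳ-≤ C B≤x+v+1) ⟩
    A * (C * suc (x + v))          <⟨ m<n+m _ BW>0 ⟩
    B * W + A * (C * suc (x + v))  ≡⟨ sum≡ACB ⟩
    A * (C * B)                    ∎)
    where
    open ≤-Reasoning
    W = A * u + C * y + (p + s)

    sum≡ACB : B * W + A * (C * suc (x + v)) ≡ A * (C * B)
    sum≡ACB = begin-equality
      (suc p + s) * (suc p * u + (suc p + s + s) * y + (p + s)) + suc p * ((suc p + s + s) * suc (x + v))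
        ≡⟨ solve (p ∷ s ∷ x ∷ y ∷ u ∷ v ∷ []) ⟩
      suc p * ((suc p + s) * u + (suc p + s + s) * v) + (suc p + s + s) * (suc p * x + (suc p + s) * y)
        + (suc p + s) * (p + s) + suc p * (suc p + s + s)
        ≡⟨ cong₂ (λ α β → A * α + C * β + B * (p + s) + A * C) Bu+Cv≡h₂ Ax+By≡h₁ ⟩
      A * h₂ + C * h₁ + B * (p + s) + A * C
        ≡⟨ cong (_+ A * C) half-identity ⟩
      suc p * (suc p + s + s) * (p + s) + suc p * (suc p + s + s)
        ≡⟨ solve (p ∷ s ∷ []) ⟩
      suc p * ((suc p + s + s) * (suc p + s)) ∎

    B∣x+v+1 : B ∣ suc (x + v)
    B∣x+v+1 = coprime-divisor B⊥C (coprime-divisor (coprime-sym A⊥B)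
      (∣m+n∣m⇒∣n (subst (B ∣_) (sym sum≡ACB) (∣n⇒∣m*n A (n∣m*n C))) (m∣m*n W)))

    B≤x+v+1 : B ≤ suc (x + v)
    B≤x+v+1 = ∣⇒≤ B∣x+v+1

    BW>0 : 0 < B * W
    BW>0 = begin-strict
      0       <⟨ >-nonZero⁻¹ s ⟩
      s       ≤⟨ m≤n+m s p ⟩
      p + s   ≤⟨ m≤n+m (p + s) (A * u + C * y) ⟩
      W       ≤⟨ m≤n*m W B ⟩
      B * W   ∎

  overshoot⇒representable-next : ∀ {x v k} → x + v ≡ p + s → A * x ≡ h₁ + B * suc k →
                                 Representable B C h₂
  overshoot⇒representable-next {x} {v} {k} x+v≡p+s Ax≡h₁+Bk = solution A∣m
    where
    open ≡-Reasoning
    m = suc s + C * k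

    Ah₂≡ACv+Bm : A * h₂ ≡ A * (C * v) + B * m
    Ah₂≡ACv+Bm = +-cancelʳ-≡ (C * h₁ + B * (p + s)) _ _ (begin
      A * h₂ + (C * h₁ + B * (p + s))  ≡⟨ +-assoc (A * h₂) _ _ ⟨
      A * h₂ + C * h₁ + B * (p + s)    ≡⟨ half-identity ⟩
      A * C * (p + s)                  ≡⟨ cong (A * C *_) x+v≡p+s ⟨
      suc p * (suc p + s + s) * (x + v)
        ≡⟨ solve (p ∷ s ∷ x ∷ v ∷ []) ⟩
      suc p * ((suc p + s + s) * v) + (suc p + s + s) * (suc p * x)
        ≡⟨ cong (λ t → A * (C * v) + C * t) Ax≡h₁+Bk ⟩
      suc p * ((suc p + s + s) * v) + (suc p + s + s) * (h₁ + (suc p + s) * suc k)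
        ≡⟨ solve (p ∷ s ∷ v ∷ k ∷ h₁ ∷ []) ⟩
      suc p * ((suc p + s + s) * v) + (suc p + s) * (suc s + (suc p + s + s) * k)
        + ((suc p + s + s) * h₁ + (suc p + s) * (p + s)) ∎)

    A∣m : A ∣ m
    A∣m = coprime-divisor A⊥B (∣m+n∣m⇒∣n (subst (A ∣_) Ah₂≡ACv+Bm (m∣m*n h₂)) (m∣m*n (C * v)))

    solution : A ∣ m → Representable B C h₂
    solution (divides u m≡uA) = u , v , *-cancelˡ-≡ _ _ A (begin
      suc p * ((suc p + s) * u + (suc p + s + s) * v)
        ≡⟨ solve (p ∷ s ∷ u ∷ v ∷ []) ⟩
      suc p * ((suc p + s + s) * v) + (suc p + s) * (u * suc p)
        ≡⟨ cong (λ t → A * (C * v) + B * t) m≡uA ⟨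
      A * (C * v) + B * m  ≡⟨ Ah₂≡ACv+Bm ⟨
      A * h₂               ∎)

  representable-or-next : Representable A B h₁ ⊎ Representable B C h₂
  representable-or-next with representable-or-overshoots A⊥B h₁
  ... | inj₁ representable = inj₁ representable
  ... | inj₂ (x , x<B , k , overshoot) =
    inj₂ (overshoot⇒representable-next (proj₂ (m≤n⇒∃[o]m+o≡n (≤-pred x<B))) overshoot)

exactly-one-usesE1 : ∀ {A s} .{{_ : NonZero A}} .{{_ : NonZero s}} → Coprime A s →
  (UsesE1 A (A + s) ⊎ UsesE1 (A + s) (A + s + s)) × ¬ (UsesE1 A (A + s) × UsesE1 (A + s) (A + s + s))
exactly-one-usesE1 {suc p} {s} A⊥s = representable-or-next , ¬representable-both
  where
  B = suc p + s
  open Consecutive p s A⊥s {half (suc p) B} {half B (B + s)}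
                   (half-exact (coprime-m,m+n A⊥s)) (half-exact (coprime-m,m+n (coprime-+ʳ A⊥s)))

GammaAlternates : (ℕ → ℕ) → Set
GammaAlternates t =
  (∀ n → n ≥ 1 → (Even n → GammaIs (t n) (t (suc n)) 2) × (¬ Even n → GammaIs (t n) (t (suc n)) 1)) ⊎
  (∀ n → n ≥ 1 → (Even n → GammaIs (t n) (t (suc n)) 1) × (¬ Even n → GammaIs (t n) (t (suc n)) 2))

module Progression {a s : ℕ} {{a≢0 : NonZero a}} {{_ : NonZero s}} (a⊥s : Coprime a s) where

  term : ℕ → ℕ
  term zero = a
  term (suc m) = term m + s

  term-nonZero : ∀ m → NonZero (term m)
  term-nonZero zero = a≢0
  term-nonZero (suc m) =
    >-nonZero (<-≤-trans (>-nonZero⁻¹ (term m) {{term-nonZero m}}) (m≤m+n (term m) s))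

  term-coprime : ∀ m → Coprime (term m) s
  term-coprime zero = a⊥s
  term-coprime (suc m) = coprime-+ʳ (term-coprime m)

  UsesE1-at : ℕ → Set
  UsesE1-at m = UsesE1 (term m) (term (suc m))

  usesE1-alternates : ∀ m → (UsesE1-at m ⊎ UsesE1-at (suc m)) × ¬ (UsesE1-at m × UsesE1-at (suc m))
  usesE1-alternates m = exactly-one-usesE1 {{term-nonZero m}} (term-coprime m)

  ap-scaled : ∀ d m → ap (d * a) (d * s) (suc m) ≡ d * term m
  ap-scaled d zero = +-identityʳ (d * a)
  ap-scaled d (suc m) = begin
    d * a + suc m * (d * s)        ≡⟨ solve (d ∷ a ∷ s ∷ m ∷ []) ⟩
    (d * a + m * (d * s)) + d * s  ≡⟨ cong (_+ d * s) (ap-scaled d m) ⟩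
    d * term m + d * s             ≡⟨ *-distribˡ-+ d (term m) s ⟨
    d * (term m + s)               ∎
    where open ≡-Reasoning

  gammaIs-at : ∀ d m →
    (UsesE1-at m → GammaIs (ap (d * a) (d * s) (suc m)) (ap (d * a) (d * s) (suc (suc m))) 1) ×
    (¬ UsesE1-at m → GammaIs (ap (d * a) (d * s) (suc m)) (ap (d * a) (d * s) (suc (suc m))) 2)
  gammaIs-at d m rewrite ap-scaled d m | ap-scaled d (suc m) =
    gammaIs-scaled d (coprime-m,m+n (term-coprime m))

  gammaAlternates : ∀ d → GammaAlternates (ap (d * a) (d * s))
  gammaAlternates d with parity-pattern (proj₁ ∘ usesE1-alternates) (proj₂ ∘ usesE1-alternates)
  ... | inj₁ on-evens = inj₁ λ { (suc m) _ →
    (λ even → proj₂ (gammaIs-at d m) (proj₂ (on-evens m) (even-suc⇒¬even even))) ,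
    (λ odd → proj₁ (gammaIs-at d m) (proj₁ (on-evens m) (¬even-suc⇒even odd))) }
  ... | inj₂ on-odds = inj₂ λ { (suc m) _ →
    (λ even → proj₁ (gammaIs-at d m) (proj₂ (on-odds m) (even-suc⇒¬even even))) ,
    (λ odd → proj₂ (gammaIs-at d m) (proj₁ (on-odds m) (¬even-suc⇒even odd))) }

theorem1p4 : (a r : ℕ) → a ≥ 1 → r ≥ 1 →
    ((∀ n → n ≥ 1 → (Even n → GammaIs (ap a r n) (ap a r (suc n)) 2)
                  × (¬ Even n → GammaIs (ap a r n) (ap a r (suc n)) 1)) ⊎
     (∀ n → n ≥ 1 → (Even n → GammaIs (ap a r n) (ap a r (suc n)) 1)
                  × (¬ Even n → GammaIs (ap a r n) (ap a r (suc n)) 2)))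
theorem1p4 a r a≥1 r≥1 with coprime-decomposition a r {{>-nonZero a≥1}}
... | d , a′ , s , refl , refl , a′⊥s =
  Progression.gammaAlternates {{m*n≢0⇒n≢0 d {{>-nonZero a≥1}}}} {{m*n≢0⇒n≢0 d {{>-nonZero r≥1}}}} a′⊥s d
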